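{- Let $n$ be a positive integer and let $g : P_d(n+1) \setminus P_c(n+1) \to P_d(n)$ be the map defined below. If $\lambda = (\lambda_1, \ldots, \lambda_k) \in P_d(n) \setminus \{(n)\}$, with $\lambda_1 < \cdots < \lambda_k$, satisfies $\lambda_k - \lambda_{k-1} > 2$, then $\lambda$ has exactly one preimage under $g$.
   Context: $P_d(m)$ is the set of partitions of $m$ into distinct parts; $P_c(m) \subseteq P_d(m)$ is the subset whose parts are consecutive integers (including one-part partitions); $(n)$ is the one-part partition of $n$. Write $\lambda \in P_d(n+1)\setminus P_c(n+1)$ as $\lambda = (\lambda_1, \ldots, \lambda_k)$ with $\lambda_1 < \cdots < \lambda_k$; let $m$ be the largest index with $\lambda_m > \lambda_{m-1} + 1$, and define $g(\lambda) = (\lambda_1, \ldots, \lambda_{m-1}, \lambda_m - 1, \lambda_{m+1}, \ldots, \lambda_k)$. -}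

module Defs where

open import Data.Nat using (ℕ; zero; suc; pred; _<_; _<ᵇ_; _+_)
open import Data.List using (List; []; _∷_)
open import Data.Nat.ListAction using (sum)
open import Data.List.Relation.Unary.All using (All)
open import Data.List.Relation.Unary.Linked using (Linked)
open import Data.Maybe using (Maybe; just; nothing; fromMaybe)
open import Data.Bool using (if_then_else_)
open import Data.Product using (_×_)
open import Relation.Binary.PropositionalEquality using (_≡_)
open import Relation.Nullary using (¬_)

Pd : ℕ → List ℕ → Set
Pd m ps = Linked _<_ ps × All (0 <_) ps × sum ps ≡ m

ConsecutiveParts : List ℕ → Set
ConsecutiveParts ps = Linked (λ a b → b ≡ suc a) ps

Pc : ℕ → List ℕ → Set
Pc m ps = Pd m ps × ConsecutiveParts ps

-- gAux λ: finds the LARGEST index j with λⱼ > λⱼ₋₁ + 1 and decreases λⱼ by 1;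
-- returns nothing if there is no such index.
gAux : List ℕ → Maybe (List ℕ)
gAux [] = nothing
gAux (x ∷ []) = nothing
gAux (x ∷ y ∷ rest) with gAux (y ∷ rest)
... | just r  = just (x ∷ r)
... | nothing = if suc x <ᵇ y then just (x ∷ pred y ∷ rest) else nothing

-- the map g (only meaningful on P_d(n+1) \ P_c(n+1), where gAux always succeeds;
-- elsewhere it is the identity, but it is only ever applied to that domain)
g : List ℕ → List ℕ
g ps = fromMaybe ps (gAux ps)

DomG : ℕ → List ℕ → Set
DomG n μ = Pd (suc n) μ × ¬ ConsecutiveParts μ

module Submission where

-- g lowers exactly one part by one, and it lowers the largest part precisely when the
-- last gap λₖ − λₖ₋₁ of its argument exceeds 1. So the unique candidate preimage of λ is
-- λ with its largest part raised by one. Any other preimage ν would have last gap at most 1,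
-- and lowering a single part widens the last gap by at most one, so g ν would have last gap
-- at most 2.

open import Defs
open import Data.Nat using (ℕ; zero; suc; pred; _<_; _≤_; _∸_; _+_; _<ᵇ_; _<?_; z≤n; s≤s; z<s)
open import Data.Nat.Properties
open import Data.Nat.ListAction using (sum)
open import Data.Nat.ListAction.Properties using (sum-++)
open import Data.List using (List; []; _∷_; _++_; _∷ʳ_)
open import Data.List.Properties using (∷ʳ-injective; ++-assoc)
open import Data.List.Relation.Unary.All.Properties using (++⁺; ++⁻ˡ; ++⁻ʳ)
open import Data.List.Relation.Unary.All using ([]; _∷_)
open import Data.List.Relation.Unary.Linked using (Linked; [-]; _∷_)
open import Data.Maybe using (just; nothing; fromMaybe)
open import Data.Maybe.Properties using (just-injective)
open import Data.Bool using (true)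
open import Data.Product using (Σ; ∃-syntax; _×_; _,_)
open import Relation.Binary.Core using (Rel)
open import Relation.Binary.PropositionalEquality using (_≡_; refl; sym; trans; cong; subst; module ≡-Reasoning)
open import Relation.Nullary using (¬_; yes; no; contradiction)

module _ {A : Set} where

  split-last-two : ∀ (x y : A) l → ∃[ ys ] ∃[ c ] ∃[ d ] x ∷ y ∷ l ≡ ys ++ c ∷ d ∷ []
  split-last-two x y []      = [] , x , y , refl
  split-last-two x y (z ∷ l) with ys , c , d , eq ← split-last-two y z l =
    x ∷ ys , c , d , cong (x ∷_) eq

  ++-last-two-injective : ∀ (ys xs : List A) {c d a b} →
    ys ++ c ∷ d ∷ [] ≡ xs ++ a ∷ b ∷ [] → ys ≡ xs × c ≡ a × d ≡ b
  ++-last-two-injective ys xs eq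
    with ys∷ʳc≡xs∷ʳa , refl ← ∷ʳ-injective (ys ∷ʳ _) (xs ∷ʳ _)
           (trans (++-assoc ys _ _) (trans eq (sym (++-assoc xs _ _))))
    with refl , refl ← ∷ʳ-injective ys xs ys∷ʳc≡xs∷ʳa = refl , refl , refl

  module _ {ℓ} {R : Rel A ℓ} where

    Linked-last-two : ∀ xs {a b} → Linked R (xs ++ a ∷ b ∷ []) → R a b
    Linked-last-two []           (Rab ∷ [-]) = Rab
    Linked-last-two (x ∷ [])     (_ ∷ Rs)    = Linked-last-two [] Rs
    Linked-last-two (x ∷ y ∷ xs) (_ ∷ Rs)    = Linked-last-two (y ∷ xs) Rs

    Linked-replace-last : ∀ xs {a b b′} → R a b′ →
      Linked R (xs ++ a ∷ b ∷ []) → Linked R (xs ++ a ∷ b′ ∷ [])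
    Linked-replace-last []           Rab′ (_ ∷ [-]) = Rab′ ∷ [-]
    Linked-replace-last (x ∷ [])     Rab′ (Rxa ∷ Rs) = Rxa ∷ Linked-replace-last [] Rab′ Rs
    Linked-replace-last (x ∷ y ∷ xs) Rab′ (Rxy ∷ Rs) = Rxy ∷ Linked-replace-last (y ∷ xs) Rab′ Rs

Pd-raise-last : ∀ {n} xs {a b} → Pd n (xs ++ a ∷ b ∷ []) → Pd (suc n) (xs ++ a ∷ suc b ∷ [])
Pd-raise-last {n} xs {a} {b} (linked , positive , Σ≡n) =
  Linked-replace-last xs (m<n⇒m<1+n (Linked-last-two xs linked)) linked ,
  ++⁺ (++⁻ˡ xs positive) (a-positive ∷ z<s ∷ []) ,
  sum-raise
  where
  a-positive : 0 < a
  a-positive with a>0 ∷ _ ← ++⁻ʳ xs positive = a>0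

  sum-raise : sum (xs ++ a ∷ suc b ∷ []) ≡ suc n
  sum-raise = begin
    sum (xs ++ a ∷ suc b ∷ [])        ≡⟨ sum-++ xs _ ⟩
    sum xs + (a + suc (b + 0))        ≡⟨ cong (sum xs +_) (+-suc a _) ⟩
    sum xs + suc (a + (b + 0))        ≡⟨ +-suc (sum xs) _ ⟩
    suc (sum xs + (a + (b + 0)))      ≡⟨ cong suc (sum-++ xs _) ⟨
    suc (sum (xs ++ a ∷ b ∷ []))      ≡⟨ cong suc Σ≡n ⟩
    suc n                             ∎
    where open ≡-Reasoning

lastGap : List ℕ → ℕ
lastGap []              = 0
lastGap (x ∷ [])        = 0
lastGap (x ∷ y ∷ [])    = y ∸ x
lastGap (x ∷ y ∷ z ∷ l) = lastGap (y ∷ z ∷ l)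

lastGap-++ : ∀ xs a b → lastGap (xs ++ a ∷ b ∷ []) ≡ b ∸ a
lastGap-++ []               a b = refl
lastGap-++ (x ∷ [])         a b = refl
lastGap-++ (x ∷ y ∷ [])     a b = refl
lastGap-++ (x ∷ y ∷ z ∷ xs) a b = lastGap-++ (y ∷ z ∷ xs) a b

data PartLowered : List ℕ → List ℕ → Set where
  here  : ∀ {x l} → PartLowered (x ∷ l) (pred x ∷ l)
  there : ∀ {x l r} → PartLowered l r → PartLowered (x ∷ l) (x ∷ r)

∸-pred-≤ : ∀ m n → m ∸ pred n ≤ suc (m ∸ n)
∸-pred-≤ m       zero          = n≤1+n m
∸-pred-≤ zero    (suc n)       = ≤-trans (m∸n≤m 0 n) z≤n
∸-pred-≤ (suc m) (suc zero)    = ≤-refl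
∸-pred-≤ (suc m) (suc (suc n)) = ∸-pred-≤ m (suc n)

lastGap-lowered : ∀ {l r} → PartLowered l r → lastGap r ≤ suc (lastGap l)
lastGap-lowered (here {x} {[]})                  = z≤n
lastGap-lowered (here {x} {y ∷ []})              = ∸-pred-≤ y x
lastGap-lowered (here {x} {y ∷ z ∷ l})           = n≤1+n _
lastGap-lowered (there {x} (here {y} {[]}))      = ≤-trans (∸-monoˡ-≤ x pred[n]≤n) (n≤1+n _)
lastGap-lowered (there (here {y} {z ∷ l}))       = lastGap-lowered (here {y} {z ∷ l})
lastGap-lowered (there p@(there here))           = lastGap-lowered p
lastGap-lowered (there p@(there (there _)))      = lastGap-lowered p

gAux-lowers-part : ∀ l {r} → gAux l ≡ just r → PartLowered l r
gAux-lowers-part (x ∷ y ∷ l) eq with gAux (y ∷ l) in e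
gAux-lowers-part (x ∷ y ∷ l) refl | just r = there (gAux-lowers-part (y ∷ l) e)
gAux-lowers-part (x ∷ y ∷ l) eq   | nothing with suc x <ᵇ y
gAux-lowers-part (x ∷ y ∷ l) refl | nothing | true = there here

gAux-∷ : ∀ x l {r} → gAux l ≡ just r → gAux (x ∷ l) ≡ just (x ∷ r)
gAux-∷ x (y ∷ z ∷ l) eq rewrite eq = refl

gAux-lowers-last : ∀ ys {c d} → suc c < d → gAux (ys ++ c ∷ d ∷ []) ≡ just (ys ++ c ∷ pred d ∷ [])
gAux-lowers-last []       {c} {d} c+1<d with suc c <ᵇ d | <⇒<ᵇ c+1<d
... | true | _ = refl
gAux-lowers-last (y ∷ ys) c+1<d = gAux-∷ y (ys ++ _) (gAux-lowers-last ys c+1<d)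

gAux-preimage-last-two : ∀ ys c d xs a b → 2 < b ∸ a →
  gAux (ys ++ c ∷ d ∷ []) ≡ just (xs ++ a ∷ b ∷ []) → ys ++ c ∷ d ∷ [] ≡ xs ++ a ∷ suc b ∷ []
gAux-preimage-last-two ys c d xs a b gap e with suc c <? d
... | yes c+1<d@(s≤s _)
  with refl , refl , refl ← ++-last-two-injective ys xs
         (just-injective (trans (sym (gAux-lowers-last ys c+1<d)) e)) = refl
... | no c+1≮d = contradiction gap (≤⇒≯ (begin
  b ∸ a                            ≡⟨ lastGap-++ xs a b ⟨
  lastGap (xs ++ a ∷ b ∷ [])       ≤⟨ lastGap-lowered (gAux-lowers-part (ys ++ c ∷ d ∷ []) e) ⟩
  suc (lastGap (ys ++ c ∷ d ∷ [])) ≡⟨ cong suc (lastGap-++ ys c d) ⟩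
  suc (d ∸ c)                      ≤⟨ s≤s (∸-monoˡ-≤ c (≮⇒≥ c+1≮d)) ⟩
  suc (suc c ∸ c)                  ≡⟨ cong suc (m+n∸n≡m 1 c) ⟩
  2                                ∎))
  where open ≤-Reasoning

gAux-preimage : ∀ ν xs a b → 2 < b ∸ a → gAux ν ≡ just (xs ++ a ∷ b ∷ []) →
  ν ≡ xs ++ a ∷ suc b ∷ []
gAux-preimage (x ∷ y ∷ l) xs a b gap e with ys , c , d , ν≡ ← split-last-two x y l =
  trans ν≡ (gAux-preimage-last-two ys c d xs a b gap (subst (λ ν → gAux ν ≡ _) ν≡ e))

mainTheorem10 : (n : ℕ) → 0 < n → (λ' : List ℕ) → Pd n λ' → ¬ (λ' ≡ n ∷ [])
    → (xs : List ℕ) → (a b : ℕ) → λ' ≡ xs ++ a ∷ b ∷ [] → 2 < b ∸ a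
    → Σ (List ℕ) (λ μ → (DomG n μ × g μ ≡ λ')
    × ((ν : List ℕ) → DomG n ν → g ν ≡ λ' → ν ≡ μ))
mainTheorem10 n _ _ λ∈Pd@(linked , _ , Σλ≡n) _ xs a b refl gap =
  μ , ((μ∈Pd , μ-not-consecutive) , cong (fromMaybe μ) (gAux-lowers-last xs a+1<b+1)) , unique
  where
  μ : List ℕ
  μ = xs ++ a ∷ suc b ∷ []

  a+1<b+1 : suc a < suc b
  a+1<b+1 = s≤s (Linked-last-two xs linked)

  μ∈Pd : Pd (suc n) μ
  μ∈Pd = Pd-raise-last xs λ∈Pd

  μ-not-consecutive : ¬ ConsecutiveParts μ
  μ-not-consecutive consecutive with refl ← Linked-last-two xs consecutive =
    contradiction (subst (2 <_) (n∸n≡0 a) gap) λ ()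

  unique : (ν : List ℕ) → DomG n ν → g ν ≡ xs ++ a ∷ b ∷ [] → ν ≡ μ
  unique ν ((_ , _ , Σν≡n+1) , _) gν≡λ with gAux ν in e
  ... | nothing = contradiction (trans (sym Σν≡n+1) (trans (cong sum gν≡λ) Σλ≡n)) 1+n≢n
  ... | just r  = gAux-preimage ν xs a b gap (trans e (cong just gν≡λ))
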